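{- Let $B$ be an integral base-polyhedron in $\mathbb{R}^S$. An element $m$ of $B\cap\mathbb{Z}^S$ minimizes $\sum_{s\in S}z(s)^2$ over $z\in B\cap\mathbb{Z}^S$ if and only if $m$ is a decreasingly minimal element of $B\cap\mathbb{Z}^S$.
   Context: $S$ is a finite non-empty set. An integral base-polyhedron is $B=B'(p)=\{x\in\mathbb{R}^S:\widetilde x(S)=p(S),\ \widetilde x(Z)\ge p(Z)\ \forall Z\subset S\}$, $\widetilde x(Z)=\sum_{s\in Z}x(s)$, with $p$ a set-function with values in $\mathbb{Z}\cup\{ -\infty\}$, $p(\emptyset)=0$, $p(S)$ finite, supermodular ($p(X)+p(Y)\le p(X\cap Y)+p(X\cup Y)$ whenever finite). With $x{\downarrow}$ the decreasing rearrangement, $m$ is decreasingly minimal in $B\cap\mathbb{Z}^S$ if for every $y$ in it, $m{\downarrow}=y{\downarrow}$ or $m{\downarrow}(j)<y{\downarrow}(j)$ at the first differing index. -}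

module Defs where

open import Data.Nat using (ℕ; suc)
open import Data.Integer using (ℤ; _+_; _*_; _≤_; _<_; 0ℤ)
import Data.Integer.Properties as ℤP
open import Data.Fin using (Fin)
open import Data.Fin.Subset using (Subset; Side; inside; outside; _∩_; _∪_; ⊤)
open import Data.Vec using (lookup)
open import Data.List using (List; []; _∷_; map; foldr)
open import Data.List.Base using (length)
open import Data.Fin.Base using ()
open import Data.Maybe using (Maybe; just; nothing)
open import Data.Product using (_×_; Σ; _,_)
open import Data.Sum using (_⊎_)
open import Data.Unit using () renaming (⊤ to Unit)
open import Data.Empty using (⊥)
open import Relation.Binary.PropositionalEquality using (_≡_; _≢_)
import Relation.Binary.Construct.Flip.EqAndOrd as Flip
import Data.List.Sort as Sort
open import Data.List using (allFin) public

-- The ground set S is Fin n (n ≥ 1 is imposed in the statement).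
-- Extended integers ℤ ∪ {-∞}: nothing represents -∞.
ℤ∞ : Set
ℤ∞ = Maybe ℤ

_≤∞_ : ℤ∞ → ℤ∞ → Set
nothing ≤∞ _ = Unit
just a ≤∞ nothing = ⊥
just a ≤∞ just b = a ≤ b

_+∞_ : ℤ∞ → ℤ∞ → ℤ∞
nothing +∞ _ = nothing
just a +∞ nothing = nothing
just a +∞ just b = just (a + b)

Σℤ : List ℤ → ℤ
Σℤ = foldr _+_ 0ℤ

ΣS : ∀ {n} → (Fin n → ℤ) → ℤ
ΣS {n} f = Σℤ (map f (allFin n))

indicator : Side → ℤ → ℤ
indicator inside  a = a
indicator outside a = 0ℤ

x̃ : ∀ {n} → (Fin n → ℤ) → Subset n → ℤ
x̃ x Z = ΣS (λ s → indicator (lookup Z s) (x s))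

record IsSupermodularSetFn {n : ℕ} (p : Subset n → ℤ∞) : Set where
  field
    p-empty : p Data.Fin.Subset.⊥ ≡ just 0ℤ
    p-full-finite : Σ ℤ (λ c → p ⊤ ≡ just c)
    supermodular : ∀ X Y → p X ≢ nothing → p Y ≢ nothing →
      (p X +∞ p Y) ≤∞ (p (X ∩ Y) +∞ p (X ∪ Y))

InB : ∀ {n} → (Subset n → ℤ∞) → (Fin n → ℤ) → Set
InB p x = (just (x̃ x ⊤) ≡ p ⊤) × (∀ Z → p Z ≤∞ just (x̃ x Z))

module Desc = Sort (Flip.decTotalOrder ℤP.≤-decTotalOrder)

_↓ : ∀ {n} → (Fin n → ℤ) → List ℤ
_↓ {n} x = Desc.sort (map x (allFin n))

LexLeq : List ℤ → List ℤ → Set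
LexLeq [] [] = Unit
LexLeq [] (_ ∷ _) = ⊥
LexLeq (_ ∷ _) [] = ⊥
LexLeq (a ∷ as) (b ∷ bs) = (a < b) ⊎ ((a ≡ b) × LexLeq as bs)

DecMin : ∀ {n} → (Subset n → ℤ∞) → (Fin n → ℤ) → Set
DecMin p m = InB p m × (∀ y → InB p y → LexLeq (m ↓) (y ↓))

sqSum : ∀ {n} → (Fin n → ℤ) → ℤ
sqSum z = ΣS (λ s → z s * z s)

SqMin : ∀ {n} → (Subset n → ℤ∞) → (Fin n → ℤ) → Set
SqMin p m = InB p m × (∀ z → InB p z → sqSum m ≤ sqSum z)

-- Both properties are equivalent to m admitting no tightening step, i.e. no s, t with
-- m(t) ≥ m(s) + 2 and m + χ_s − χ_t ∈ B. Such a step strictly lowers Σ z² and raises no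
-- Σ (z − k)⁺, which rules it out for either kind of minimiser. Conversely, if m admits none and
-- y ≠ m lies in B, two applications of the exchange property of B (its tight sets are closed
-- under ∩ by supermodularity) give s, t with y(t) < y(s) and y + χ_t − χ_s ∈ B strictly closer
-- to m. Hence m minimises every separable discrete-convex Σ F(z(s)) over B ∩ ℤ^S: F(v) = v² gives
-- square-sum minimality, and F(v) = (v − k)⁺ for all k gives decreasing minimality.

module Submission where

open import Defs
open import Data.Nat using (ℕ; zero; suc; s≤s; z≤n)
import Data.Nat as ℕ
import Data.Nat.Properties as NP
import Data.Nat.Induction as NI
open import Data.Integer
  using (ℤ; _+_; _-_; -_; _*_; _≤_; _<_; _≥_; _⊔_; 0ℤ; 1ℤ; pred; +≤+; +<+; ∣_∣)
  renaming (suc to sucℤ)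
import Data.Integer.Properties as ZP
open import Data.Integer.Tactic.RingSolver using (solve-∀)
open import Data.Fin using (Fin; zero; suc)
import Data.Fin.Properties as FP
open import Data.Fin.Subset using (Subset; inside; outside; _∩_; _∪_; ⊤; _∈_; _∉_)
open import Data.Fin.Subset.Properties using (∈⊤; x∈p∩q⁺; p∩q⊆p; p∩q⊆q; anySubset?)
open import Data.Bool using (_∧_; _∨_)
open import Data.List using (List; []; _∷_; map; length; tabulate; filter)
import Data.List.Properties as LP
open import Data.List.Membership.Propositional using () renaming (_∈_ to _∈ₗ_)
open import Data.List.Membership.Propositional.Properties using (∈-allFin; ∈-filter⁺; ∈-filter⁻)
open import Data.List.Relation.Unary.Any using (here; there)
open import Data.List.Relation.Unary.All using (All; []; _∷_)
import Data.List.Relation.Unary.All as All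
open import Data.List.Relation.Unary.All.Properties using (all-filter)
open import Data.List.Relation.Unary.AllPairs using (AllPairs; []; _∷_)
open import Data.List.Relation.Unary.Linked.Properties using (Linked⇒AllPairs)
open import Data.List.Relation.Binary.Permutation.Propositional using (↭⇒↭ₛ)
import Data.List.Relation.Binary.Permutation.Propositional.Properties as ↭
open import Data.List.Relation.Binary.Permutation.Setoid.Properties using (foldr-commMonoid)
import Data.List.Extrema ZP.≤-totalOrder as Extrema
open import Data.Maybe using (just; nothing)
import Data.Maybe.Properties as MP
open import Data.Vec using (lookup)
open import Data.Vec.Properties using (lookup-zipWith; lookup-replicate; []=⇒lookup; lookup⇒[]=)
open import Data.Vec.Functional using (updateAt)
open import Data.Vec.Functional.Properties using (updateAt-minimal; ≗-dec)
open import Data.Product using (Σ-syntax; ∃-syntax; _×_; _,_; proj₁; proj₂)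
open import Data.Sum using (inj₁; inj₂)
open import Data.Unit using (tt)
open import Data.Empty using (⊥-elim)
open import Function using (id; _∘_; _∘′_)
open import Function.Bundles using (_⇔_; mk⇔)
open import Induction.WellFounded using (Acc; acc; WellFounded)
open import Level using (0ℓ)
open import Relation.Nullary using (¬_; Dec; yes; no; ¬?)
open import Relation.Nullary.Decidable using (decidable-stable; _×-dec_)
open import Relation.Unary using (Pred; Decidable)
open import Relation.Binary using (Rel)
open import Relation.Binary.Definitions using (tri<; tri≈; tri>)
import Relation.Binary.Construct.On as On
open import Relation.Binary.PropositionalEquality
open import Algebra.Properties.CommutativeMonoid.Sum ZP.+-0-commutativeMonoid
  using (sum; ∑-distrib-+; sum-cong-≗; sum-replicate-zero)

ΣS≡sum : ∀ {n} (f : Fin n → ℤ) → ΣS f ≡ sum f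
ΣS≡sum {n} f = trans (cong Σℤ (LP.map-tabulate id f)) (Σℤ-tabulate f)
  where
  Σℤ-tabulate : ∀ {n} (f : Fin n → ℤ) → Σℤ (tabulate f) ≡ sum f
  Σℤ-tabulate {zero} f = refl
  Σℤ-tabulate {suc n} f = cong (f zero +_) (Σℤ-tabulate (λ e → f (suc e)))

sum-mono-≤ : ∀ {n} {f g : Fin n → ℤ} → (∀ e → f e ≤ g e) → sum f ≤ sum g
sum-mono-≤ {zero} f≤g = ZP.≤-refl
sum-mono-≤ {suc n} f≤g = ZP.+-mono-≤ (f≤g zero) (sum-mono-≤ (λ e → f≤g (suc e)))

sum-mono-< : ∀ {n} {f g : Fin n → ℤ} → (∀ e → f e ≤ g e) → ∀ a → f a < g a → sum f < sum g
sum-mono-< {suc n} f≤g zero fa<ga = ZP.+-mono-<-≤ fa<ga (sum-mono-≤ (λ e → f≤g (suc e)))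
sum-mono-< {suc n} f≤g (suc a) fa<ga =
  ZP.+-mono-≤-< (f≤g zero) (sum-mono-< (λ e → f≤g (suc e)) a fa<ga)

sum-updateAt : ∀ {n} (G : Fin n → ℤ → ℤ) (z : Fin n → ℤ) a (f : ℤ → ℤ) →
  sum (λ e → G e (updateAt z a f e)) ≡ sum (λ e → G e (z e)) + (G a (f (z a)) - G a (z a))
sum-updateAt {suc n} G z zero f = shift (G zero (z zero)) (G zero (f (z zero))) _
  where
  shift : ∀ u v s → v + s ≡ (u + s) + (v - u)
  shift = solve-∀
sum-updateAt {suc n} G z (suc a) f =
  trans (cong (G zero (z zero) +_) (sum-updateAt (λ e → G (suc e)) (λ e → z (suc e)) a f))
        (sym (ZP.+-assoc (G zero (z zero)) _ _))

transfer : ∀ {n} → (Fin n → ℤ) → Fin n → Fin n → Fin n → ℤ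
transfer z a b = updateAt (updateAt z b pred) a sucℤ

Δ : (ℤ → ℤ) → ℤ → ℤ
Δ F v = F (sucℤ v) - F v

sum-transfer : ∀ {n} (G : Fin n → ℤ → ℤ) (z : Fin n → ℤ) {a b} → a ≢ b →
  sum (λ e → G e (transfer z a b e)) ≡
  sum (λ e → G e (z e)) + (Δ (G a) (z a) - Δ (G b) (pred (z b)))
sum-transfer G z {a} {b} a≢b = begin
  sum (λ e → G e (transfer z a b e))
    ≡⟨ sum-updateAt G (updateAt z b pred) a sucℤ ⟩
  sum (λ e → G e (updateAt z b pred e)) + Δ (G a) (updateAt z b pred a)
    ≡⟨ cong₂ (λ s v → s + Δ (G a) v) (sum-updateAt G z b pred) (updateAt-minimal a b z a≢b) ⟩
  S + (G b (pred (z b)) - G b (z b)) + Δ (G a) (z a)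
    ≡⟨ cong (λ v → S + (G b (pred (z b)) - G b v) + Δ (G a) (z a)) (sym (ZP.suc-pred (z b))) ⟩
  S + (G b (pred (z b)) - G b (sucℤ (pred (z b)))) + Δ (G a) (z a)
    ≡⟨ rearrange S (G b (pred (z b))) (G b (sucℤ (pred (z b)))) _ ⟩
  S + (Δ (G a) (z a) - Δ (G b) (pred (z b)))
    ∎
  where
  open ≡-Reasoning
  S = sum (λ e → G e (z e))
  rearrange : ∀ s u v d → s + (u - v) + d ≡ s + (d - (v - u))
  rearrange = solve-∀

Convex : (ℤ → ℤ) → Set
Convex F = ∀ {u v} → u ≤ v → Δ F u ≤ Δ F v

StrictlyConvex : (ℤ → ℤ) → Set
StrictlyConvex F = ∀ {u v} → u < v → Δ F u < Δ F v

i+[j-k]≤i : ∀ s {d₁ d₂} → d₁ ≤ d₂ → s + (d₁ - d₂) ≤ s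
i+[j-k]≤i s d₁≤d₂ = subst (s + _ ≤_) (ZP.+-identityʳ s) (ZP.+-monoʳ-≤ s (ZP.i≤j⇒i-j≤0 d₁≤d₂))

i+[j-k]<i : ∀ s {d₁ d₂} → d₁ < d₂ → s + (d₁ - d₂) < s
i+[j-k]<i s {d₁} {d₂} d₁<d₂ = subst (s + _ <_) (ZP.+-identityʳ s)
  (ZP.+-monoʳ-< s (subst (d₁ - d₂ <_) (ZP.+-inverseʳ d₂) (ZP.+-monoˡ-< (- d₂) d₁<d₂)))

sum-transfer-≤ : ∀ {n} F → Convex F → (z : Fin n → ℤ) {a b : Fin n} → a ≢ b → z a < z b →
  sum (λ e → F (transfer z a b e)) ≤ sum (λ e → F (z e))
sum-transfer-≤ F convex z a≢b za<zb =
  subst (_≤ _) (sym (sum-transfer (λ _ → F) z a≢b))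
    (i+[j-k]≤i _ (convex (ZP.i<j⇒i≤pred[j] za<zb)))

sum-transfer-< : ∀ {n} F → StrictlyConvex F → (z : Fin n → ℤ) {a b : Fin n} → a ≢ b →
  sucℤ (z a) < z b → sum (λ e → F (transfer z a b e)) < sum (λ e → F (z e))
sum-transfer-< F convex z a≢b 1+za<zb =
  subst (_< _) (sym (sum-transfer (λ _ → F) z a≢b))
    (i+[j-k]<i _ (convex (ZP.suc[i]≤j⇒i<j (ZP.i<j⇒i≤pred[j] 1+za<zb))))

excess : ℤ → ℤ → ℤ
excess k v = (v - k) ⊔ 0ℤ

excess-nonneg : ∀ k v → 0ℤ ≤ excess k v
excess-nonneg k v = ZP.i≤j⊔i (v - k) 0ℤ

excess-≤ : ∀ {k v} → v ≤ k → excess k v ≡ 0ℤ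
excess-≤ v≤k = ZP.i≤j⇒i⊔j≡j (ZP.i≤j⇒i-j≤0 v≤k)

excess-≥ : ∀ {k v} → k ≤ v → excess k v ≡ v - k
excess-≥ k≤v = ZP.i≥j⇒i⊔j≡i (ZP.i≤j⇒0≤j-i k≤v)

Δexcess-< : ∀ {k v} → v < k → Δ (excess k) v ≡ 0ℤ
Δexcess-< v<k = cong₂ _-_ (excess-≤ (ZP.i<j⇒suc[i]≤j v<k)) (excess-≤ (ZP.<⇒≤ v<k))

Δexcess-≥ : ∀ {k v} → k ≤ v → Δ (excess k) v ≡ 1ℤ
Δexcess-≥ {k} {v} k≤v = begin
  excess k (sucℤ v) - excess k v ≡⟨ cong₂ _-_ (excess-≥ (ZP.i≤j⇒i≤1+j k≤v)) (excess-≥ k≤v) ⟩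
  (1ℤ + v - k) - (v - k)         ≡⟨ cancel v k ⟩
  1ℤ                             ∎
  where
  open ≡-Reasoning
  cancel : ∀ v k → (1ℤ + v - k) - (v - k) ≡ 1ℤ
  cancel = solve-∀

excess-convex : ∀ k → Convex (excess k)
excess-convex k {u} {v} u≤v with k ZP.≤? u | k ZP.≤? v
... | yes k≤u | _ = ZP.≤-reflexive (trans (Δexcess-≥ k≤u) (sym (Δexcess-≥ (ZP.≤-trans k≤u u≤v))))
... | no k≰u | yes k≤v = subst₂ _≤_ (sym (Δexcess-< (ZP.≰⇒> k≰u))) (sym (Δexcess-≥ k≤v)) (+≤+ z≤n)
... | no k≰u | no k≰v = ZP.≤-reflexive (trans (Δexcess-< (ZP.≰⇒> k≰u)) (sym (Δexcess-< (ZP.≰⇒> k≰v))))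

square : ℤ → ℤ
square v = v * v

Δsquare : ∀ v → Δ square v ≡ 1ℤ + (v + v)
Δsquare v = expand v
  where
  expand : ∀ v → (1ℤ + v) * (1ℤ + v) - v * v ≡ 1ℤ + (v + v)
  expand = solve-∀

square-convex : Convex square
square-convex {u} {v} u≤v =
  subst₂ _≤_ (sym (Δsquare u)) (sym (Δsquare v)) (ZP.+-monoʳ-≤ 1ℤ (ZP.+-mono-≤ u≤v u≤v))

square-strictlyConvex : StrictlyConvex square
square-strictlyConvex {u} {v} u<v =
  subst₂ _<_ (sym (Δsquare u)) (sym (Δsquare v)) (ZP.+-monoʳ-< 1ℤ (ZP.+-mono-< u<v u<v))

x̃≡sum : ∀ {n} (z : Fin n → ℤ) Z → x̃ z Z ≡ sum (λ e → indicator (lookup Z e) (z e))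
x̃≡sum z Z = ΣS≡sum (λ e → indicator (lookup Z e) (z e))

Δindicator : ∀ s v → Δ (indicator s) v ≡ indicator s 1ℤ
Δindicator inside v = cancel v
  where
  cancel : ∀ v → (1ℤ + v) - v ≡ 1ℤ
  cancel = solve-∀
Δindicator outside v = refl

x̃-transfer : ∀ {n} (z : Fin n → ℤ) {a b} → a ≢ b → ∀ Z →
  x̃ (transfer z a b) Z ≡ x̃ z Z + (indicator (lookup Z a) 1ℤ - indicator (lookup Z b) 1ℤ)
x̃-transfer z {a} {b} a≢b Z = begin
  x̃ (transfer z a b) Z
    ≡⟨ x̃≡sum (transfer z a b) Z ⟩
  sum (λ e → G e (transfer z a b e))
    ≡⟨ sum-transfer G z a≢b ⟩
  sum (λ e → G e (z e)) + (Δ (G a) (z a) - Δ (G b) _)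
    ≡⟨ cong₂ _+_ (sym (x̃≡sum z Z))
             (cong₂ _-_ (Δindicator (lookup Z a) _) (Δindicator (lookup Z b) _)) ⟩
  x̃ z Z + (indicator (lookup Z a) 1ℤ - indicator (lookup Z b) 1ℤ)
    ∎
  where
  open ≡-Reasoning
  G = λ e → indicator (lookup Z e)

x̃-modular : ∀ {n} (z : Fin n → ℤ) X Y → x̃ z (X ∩ Y) + x̃ z (X ∪ Y) ≡ x̃ z X + x̃ z Y
x̃-modular z X Y = begin
  x̃ z (X ∩ Y) + x̃ z (X ∪ Y)
    ≡⟨ cong₂ _+_ (x̃≡sum z (X ∩ Y)) (x̃≡sum z (X ∪ Y)) ⟩
  sum (in' (X ∩ Y)) + sum (in' (X ∪ Y))
    ≡⟨ ∑-distrib-+ (in' (X ∩ Y)) (in' (X ∪ Y)) ⟨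
  sum (λ e → in' (X ∩ Y) e + in' (X ∪ Y) e)
    ≡⟨ sum-cong-≗ pointwise ⟩
  sum (λ e → in' X e + in' Y e)
    ≡⟨ ∑-distrib-+ (in' X) (in' Y) ⟩
  sum (in' X) + sum (in' Y)
    ≡⟨ cong₂ _+_ (x̃≡sum z X) (x̃≡sum z Y) ⟨
  x̃ z X + x̃ z Y
    ∎
  where
  open ≡-Reasoning
  in' : Subset _ → Fin _ → ℤ
  in' Z e = indicator (lookup Z e) (z e)
  indicator-modular : ∀ s t v → indicator (s ∧ t) v + indicator (s ∨ t) v ≡ indicator s v + indicator t v
  indicator-modular inside  inside  v = refl
  indicator-modular inside  outside v = ZP.+-comm 0ℤ v
  indicator-modular outside inside  v = refl
  indicator-modular outside outside v = refl
  pointwise : ∀ e → in' (X ∩ Y) e + in' (X ∪ Y) e ≡ in' X e + in' Y e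
  pointwise e rewrite lookup-zipWith _∧_ e X Y | lookup-zipWith _∨_ e X Y =
    indicator-modular (lookup X e) (lookup Y e) (z e)

x̃-mono-< : ∀ {n} {w x : Fin n → ℤ} {T a} → (∀ e → e ∈ T → w e ≤ x e) → a ∈ T → w a < x a →
  x̃ w T < x̃ x T
x̃-mono-< {w = w} {x} {T} {a} w≤x a∈T wa<xa =
  subst₂ _<_ (sym (x̃≡sum w T)) (sym (x̃≡sum x T)) (sum-mono-< pointwise a strict)
  where
  pointwise : ∀ e → indicator (lookup T e) (w e) ≤ indicator (lookup T e) (x e)
  pointwise e with lookup T e in eq
  ... | inside  = w≤x e (lookup⇒[]= e T eq)
  ... | outside = ZP.≤-refl
  strict : indicator (lookup T a) (w a) < indicator (lookup T a) (x a)
  strict rewrite []=⇒lookup a∈T = wa<xa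

Tight : ∀ {n} → (Subset n → ℤ∞) → (Fin n → ℤ) → Subset n → Set
Tight p x Z = p Z ≡ just (x̃ x Z)

tight-⊤ : ∀ {n} {p : Subset n → ℤ∞} {x} → InB p x → Tight p x ⊤
tight-⊤ xB = sym (proj₁ xB)

tight⇒finite : ∀ {n} {p : Subset n → ℤ∞} {x Z} → Tight p x Z → p Z ≢ nothing
tight⇒finite tZ pZ≡nothing with trans (sym tZ) pZ≡nothing
... | ()

private
  squeeze : ∀ {a b c d : ℤ} → c ≤ a → d ≤ b → a + b ≤ c + d → c ≡ a
  squeeze c≤a d≤b a+b≤c+d =
    ZP.≤-antisym c≤a (ZP.≮⇒≥ λ c<a → ZP.<⇒≱ (ZP.+-mono-<-≤ c<a d≤b) a+b≤c+d)

  squeeze∞ : ∀ {A B a b : ℤ} (c d : ℤ∞) → (just A +∞ just B) ≤∞ (c +∞ d) →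
    c ≤∞ just a → d ≤∞ just b → a + b ≡ A + B → c ≡ just a
  squeeze∞ (just c) (just d) A+B≤c+d c≤a d≤b eq =
    cong just (squeeze c≤a d≤b (subst (_≤ c + d) (sym eq) A+B≤c+d))

-- Supermodularity of p against modularity of x̃.
tight-∩ : ∀ {n} {p : Subset n → ℤ∞} {x} → IsSupermodularSetFn p → InB p x →
  ∀ {X Y} → Tight p x X → Tight p x Y → Tight p x (X ∩ Y)
tight-∩ {p = p} {x} sm xB {X} {Y} tX tY =
  squeeze∞ {A = x̃ x X} {x̃ x Y} (p (X ∩ Y)) (p (X ∪ Y))
    (subst₂ (λ u v → (u +∞ v) ≤∞ (p (X ∩ Y) +∞ p (X ∪ Y))) tX tY
      (IsSupermodularSetFn.supermodular sm X Y (tight⇒finite {p = p} {x} tX) (tight⇒finite {p = p} {x} tY)))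
    (proj₂ xB (X ∩ Y)) (proj₂ xB (X ∪ Y)) (x̃-modular x X Y)

tight-no-drop : ∀ {n} {p : Subset n → ℤ∞} {x w T a} → InB p w → Tight p x T →
  (∀ e → e ∈ T → w e ≤ x e) → a ∈ T → ¬ (w a < x a)
tight-no-drop {w = w} {T = T} wB tT w≤x a∈T wa<xa =
  ZP.<⇒≱ (x̃-mono-< w≤x a∈T wa<xa) (subst (_≤∞ just (x̃ w T)) tT (proj₂ wB T))

≤∞-just? : ∀ c v → Dec (c ≤∞ just v)
≤∞-just? nothing  v = yes tt
≤∞-just? (just c) v = c ZP.≤? v

module _ {n ℓ} {P : Pred (Subset n) ℓ} (P? : Decidable P) where

  all-Subset? : Dec (∀ Z → P Z)
  all-Subset? with anySubset? (¬? ∘ P?)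
  ... | yes (Z , ¬PZ) = no λ ∀P → ¬PZ (∀P Z)
  ... | no ¬∃¬P = yes λ Z → decidable-stable (P? Z) λ ¬PZ → ¬∃¬P (Z , ¬PZ)

  ¬∀⇒∃¬-Subset : ¬ (∀ Z → P Z) → ∃[ Z ] ¬ P Z
  ¬∀⇒∃¬-Subset ¬∀P = decidable-stable (anySubset? (¬? ∘ P?)) λ ¬∃¬P →
    ¬∀P λ Z → decidable-stable (P? Z) λ ¬PZ → ¬∃¬P (Z , ¬PZ)

InB? : ∀ {n} (p : Subset n → ℤ∞) x → Dec (InB p x)
InB? p x = MP.≡-dec ZP._≟_ (just (x̃ x ⊤)) (p ⊤) ×-dec all-Subset? (λ Z → ≤∞-just? (p Z) (x̃ x Z))

TightSeparator : ∀ {n} → (Subset n → ℤ∞) → (Fin n → ℤ) → Fin n → Fin n → Set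
TightSeparator {n} p x a q = Σ[ Z ∈ Subset n ] Tight p x Z × a ∈ Z × q ∉ Z

private
  violated-by-transfer : ∀ {X} (c : ℤ∞) sq sa → c ≤∞ just X →
    ¬ (c ≤∞ just (X + (indicator sq 1ℤ - indicator sa 1ℤ))) →
    c ≡ just X × sa ≡ inside × sq ≡ outside
  violated-by-transfer nothing _ _ _ violated = ⊥-elim (violated tt)
  violated-by-transfer {X} (just c) inside inside c≤X violated =
    ⊥-elim (violated (subst (c ≤_) (sym (ZP.+-identityʳ X)) c≤X))
  violated-by-transfer {X} (just c) inside outside c≤X violated =
    ⊥-elim (violated (ZP.≤-trans c≤X (ZP.i≤i+j X 1ℤ)))
  violated-by-transfer {X} (just c) outside outside c≤X violated =
    ⊥-elim (violated (subst (c ≤_) (sym (ZP.+-identityʳ X)) c≤X))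
  violated-by-transfer {X} (just c) outside inside c≤X violated =
    cong just (ZP.≤-antisym c≤X (subst (_≤ c) (cancel X) (ZP.i<j⇒suc[i]≤j (ZP.≰⇒> violated)))) ,
    refl , refl
    where
    cancel : ∀ X → 1ℤ + (X + (0ℤ - 1ℤ)) ≡ X
    cancel = solve-∀

x̃-transfer-⊤ : ∀ {n} (z : Fin n → ℤ) {a b} → a ≢ b → x̃ (transfer z a b) ⊤ ≡ x̃ z ⊤
x̃-transfer-⊤ z {a} {b} a≢b = begin
  x̃ (transfer z a b) ⊤
    ≡⟨ x̃-transfer z a≢b ⊤ ⟩
  x̃ z ⊤ + (indicator (lookup ⊤ a) 1ℤ - indicator (lookup ⊤ b) 1ℤ)
    ≡⟨ cong₂ (λ s t → x̃ z ⊤ + (indicator s 1ℤ - indicator t 1ℤ)) (lookup-replicate a inside) (lookup-replicate b inside) ⟩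
  x̃ z ⊤ + 0ℤ
    ≡⟨ ZP.+-identityʳ (x̃ z ⊤) ⟩
  x̃ z ⊤
    ∎
  where open ≡-Reasoning

infeasible-transfer⇒separator : ∀ {n} {p : Subset n → ℤ∞} {x q a} → InB p x → q ≢ a →
  ¬ InB p (transfer x q a) → TightSeparator p x a q
infeasible-transfer⇒separator {p = p} {x} {q} {a} xB q≢a infeasible =
  let (Z , violated) = ¬∀⇒∃¬-Subset (λ Z → ≤∞-just? (p Z) (x̃ x' Z)) (λ ok → infeasible (total , ok))
      (tZ , Za≡inside , Zq≡outside) = violated-by-transfer (p Z) (lookup Z q) (lookup Z a) (proj₂ xB Z)
        (subst (λ v → ¬ (p Z ≤∞ just v)) (x̃-transfer x q≢a Z) violated)
  in Z , tZ , lookup⇒[]= a Z Za≡inside , λ q∈Z → inside≢outside (trans (sym ([]=⇒lookup q∈Z)) Zq≡outside)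
  where
  x' = transfer x q a
  total : just (x̃ x' ⊤) ≡ p ⊤
  total = trans (cong just (x̃-transfer-⊤ x q≢a)) (proj₁ xB)
  inside≢outside : inside ≢ outside
  inside≢outside ()

tight-avoiding : ∀ {n} {p : Subset n → ℤ∞} {x a} → IsSupermodularSetFn p → InB p x →
  (qs : List (Fin n)) → (∀ {q} → q ∈ₗ qs → TightSeparator p x a q) →
  Σ[ T ∈ Subset n ] Tight p x T × a ∈ T × (∀ {q} → q ∈ₗ qs → q ∉ T)
tight-avoiding sm xB [] _ = ⊤ , tight-⊤ xB , ∈⊤ , λ ()
tight-avoiding sm xB (q ∷ qs) separator =
  let (Z , tZ , a∈Z , q∉Z) = separator (here refl)
      (T , tT , a∈T , avoids) = tight-avoiding sm xB qs (separator ∘ there)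
  in Z ∩ T , tight-∩ sm xB tZ tT , x∈p∩q⁺ (a∈Z , a∈T) ,
     λ { (here refl) → q∉Z ∘ p∩q⊆p Z T ; (there q∈qs) → avoids q∈qs ∘ p∩q⊆q Z T }

-- Otherwise every coordinate q with x q < w q is cut off from a by a tight set; their
-- intersection is a tight set containing a on which w ≤ x, impossible as w a < x a.
exchange : ∀ {n} {p : Subset n → ℤ∞} {x w} → IsSupermodularSetFn p → InB p x → InB p w →
  ∀ {a} → w a < x a → ∃[ q ] x q < w q × InB p (transfer x q a)
exchange {n} {p} {x} {w} sm xB wB {a} wa<xa =
  decidable-stable (FP.any? λ q → raises? q ×-dec InB? p (transfer x q a)) λ none →
    let (T , tT , a∈T , avoids) = tight-avoiding sm xB raised (separator none)
        w≤x : ∀ e → e ∈ T → w e ≤ x e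
        w≤x e e∈T = ZP.≮⇒≥ λ xe<we → avoids (∈-filter⁺ raises? {xs = allFin n} (∈-allFin e) xe<we) e∈T
    in tight-no-drop wB tT w≤x a∈T wa<xa
  where
  raises? : ∀ q → Dec (x q < w q)
  raises? q = x q ZP.<? w q
  raised = filter raises? (allFin n)
  separator : ¬ (∃[ q ] x q < w q × InB p (transfer x q a)) →
    ∀ {q} → q ∈ₗ raised → TightSeparator p x a q
  separator none q∈raised =
    let xq<wq = proj₂ (∈-filter⁻ raises? {xs = allFin n} q∈raised)
    in infeasible-transfer⇒separator xB (λ { refl → ZP.<-asym xq<wq wa<xa }) (λ inB → none (_ , xq<wq , inB))

Descending : List ℤ → Set
Descending = AllPairs _≥_

↓-descending : ∀ {n} (z : Fin n → ℤ) → Descending (z ↓)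
↓-descending {n} z = Linked⇒AllPairs (λ x≥y y≥z → ZP.≤-trans y≥z x≥y) (Desc.sort-↗ (map z (allFin n)))

length-↓ : ∀ {n} (z : Fin n → ℤ) → length (z ↓) ≡ n
length-↓ {n} z = begin
  length (z ↓)              ≡⟨ ↭.↭-length (Desc.sort-↭ (map z (allFin n))) ⟩
  length (map z (allFin n)) ≡⟨ LP.length-map z (allFin n) ⟩
  length (allFin n)         ≡⟨ LP.length-tabulate _ ⟩
  n                         ∎
  where open ≡-Reasoning

Σℤ-map-↓ : ∀ {n} (G : ℤ → ℤ) (z : Fin n → ℤ) → Σℤ (map G (z ↓)) ≡ sum (λ e → G (z e))
Σℤ-map-↓ {n} G z = begin
  Σℤ (map G (z ↓))
    ≡⟨ foldr-commMonoid (setoid ℤ) ZP.+-0-isCommutativeMonoid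
         (↭⇒↭ₛ (↭.map⁺ G (Desc.sort-↭ (map z (allFin n))))) ⟩
  Σℤ (map G (map z (allFin n)))
    ≡⟨ cong Σℤ (LP.map-∘ (allFin n)) ⟨
  ΣS (λ e → G (z e))
    ≡⟨ ΣS≡sum (λ e → G (z e)) ⟩
  sum (λ e → G (z e))
    ∎
  where open ≡-Reasoning

LexLeq-antisym : ∀ {a b} → LexLeq a b → LexLeq b a → a ≡ b
LexLeq-antisym {[]} {[]} _ _ = refl
LexLeq-antisym {_ ∷ _} {_ ∷ _} (inj₁ x<y) (inj₁ y<x) = ⊥-elim (ZP.<-asym x<y y<x)
LexLeq-antisym {_ ∷ _} {_ ∷ _} (inj₁ x<y) (inj₂ (refl , _)) = ⊥-elim (ZP.<-irrefl refl x<y)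
LexLeq-antisym {_ ∷ _} {_ ∷ _} (inj₂ (refl , _)) (inj₁ y<x) = ⊥-elim (ZP.<-irrefl refl y<x)
LexLeq-antisym {_ ∷ _} {_ ∷ _} (inj₂ (refl , a≤b)) (inj₂ (_ , b≤a)) = cong (_ ∷_) (LexLeq-antisym a≤b b≤a)

private
  +-cancelˡ-≤ : ∀ c {a b} → c + a ≤ c + b → a ≤ b
  +-cancelˡ-≤ c {a} {b} c+a≤c+b = subst₂ _≤_ (cancel a) (cancel b) (ZP.+-monoʳ-≤ (- c) c+a≤c+b)
    where
    cancel : ∀ v → - c + (c + v) ≡ v
    cancel v = trans (sym (ZP.+-assoc (- c) c v)) (trans (cong (_+ v) (ZP.+-inverseˡ c)) (ZP.+-identityˡ v))

Σexcess-nonneg : ∀ k xs → 0ℤ ≤ Σℤ (map (excess k) xs)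
Σexcess-nonneg k [] = ZP.≤-refl
Σexcess-nonneg k (x ∷ xs) = ZP.+-mono-≤ (excess-nonneg k x) (Σexcess-nonneg k xs)

Σexcess-≤ : ∀ {k xs} → All (_≤ k) xs → Σℤ (map (excess k) xs) ≡ 0ℤ
Σexcess-≤ [] = refl
Σexcess-≤ (x≤k ∷ xs≤k) = cong₂ _+_ (excess-≤ x≤k) (Σexcess-≤ xs≤k)

-- The head of a descending list is its largest entry, so taking k = y exposes the first difference.
excess≤⇒LexLeq : ∀ a b → Descending b → length a ≡ length b →
  (∀ k → Σℤ (map (excess k) a) ≤ Σℤ (map (excess k) b)) → LexLeq a b
excess≤⇒LexLeq [] [] _ _ _ = tt
excess≤⇒LexLeq (x ∷ a) (y ∷ b) (y≥b ∷ b↓) |a|≡|b| excess≤ with ZP.<-cmp x y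
... | tri< x<y _ _ = inj₁ x<y
... | tri≈ _ refl _ = inj₂ (refl , excess≤⇒LexLeq a b b↓ (NP.suc-injective |a|≡|b|)
                                     (λ k → +-cancelˡ-≤ (excess k x) (excess≤ k)))
... | tri> _ _ y<x = ⊥-elim (ZP.<⇒≱ positive (subst (_ ≤_) vanishing (excess≤ y)))
  where
  vanishing : excess y y + Σℤ (map (excess y) b) ≡ 0ℤ
  vanishing = cong₂ _+_ (excess-≤ {y} ZP.≤-refl) (Σexcess-≤ y≥b)
  positive : 0ℤ < excess y x + Σℤ (map (excess y) a)
  positive = ZP.<-≤-trans
    (subst (0ℤ <_) (sym (excess-≥ (ZP.<⇒≤ y<x)))
      (subst (_< x - y) (ZP.+-inverseʳ y) (ZP.+-monoˡ-< (- y) y<x)))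
    (subst (_≤ excess y x + Σℤ (map (excess y) a)) (ZP.+-identityʳ (excess y x))
      (ZP.+-monoʳ-≤ (excess y x) (Σexcess-nonneg y a)))

∃-argmax : ∀ {n ℓ} {P : Pred (Fin n) ℓ} → Decidable P → (f : Fin n → ℤ) → ∀ {t₀} → P t₀ →
  ∃[ t ] P t × (∀ {t'} → P t' → f t' ≤ f t)
∃-argmax {n} P? f {t₀} Pt₀ =
  t , Extrema.argmax-all f Pt₀ (all-filter P? (allFin n)) ,
  λ Pt' → All.lookup (Extrema.f[xs]≤f[argmax] {f = f} t₀ candidates)
                     (∈-filter⁺ P? {xs = allFin n} (∈-allFin _) Pt')
  where
  candidates = filter P? (allFin n)
  t = Extrema.argmax f t₀ candidates

coordinate-<⇒≢ : ∀ {n} {z : Fin n → ℤ} {a b} → z a < z b → a ≢ b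
coordinate-<⇒≢ za<zb refl = ZP.<-irrefl refl za<zb

NoTighteningStep : ∀ {n} → (Subset n → ℤ∞) → (Fin n → ℤ) → Set
NoTighteningStep p m = ∀ s t → sucℤ (m s) < m t → ¬ InB p (transfer m s t)

module Descent {n} {p : Subset n → ℤ∞} {m : Fin n → ℤ}
  (sm : IsSupermodularSetFn p) (mB : InB p m) (noStep : NoTighteningStep p m) where

  ∃-coordinate-< : ∀ {y} → InB p y → ¬ (y ≗ m) → ∃[ t ] y t < m t
  ∃-coordinate-< {y} yB y≉m = decidable-stable (FP.any? λ t → y t ZP.<? m t) λ none →
    let m≤y : ∀ e → m e ≤ y e
        m≤y e = ZP.≮⇒≥ λ ye<me → none (e , ye<me)
    in y≉m λ e → ZP.≤-antisym (ZP.≮⇒≥ (tight-no-drop mB (tight-⊤ yB) (λ e _ → m≤y e) ∈⊤)) (m≤y e)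

  -- Exchange from m towards y at a coordinate tₘ maximising m among those where y is below m,
  -- then from y back towards m; the absence of tightening steps at m forces y t < y s.
  improving-transfer : ∀ {y} → InB p y → ¬ (y ≗ m) →
    ∃[ s ] ∃[ t ] m s < y s × y t < m t × y t < y s × InB p (transfer y t s)
  improving-transfer {y} yB y≉m =
    let (t₀ , below₀) = ∃-coordinate-< yB y≉m
        (tₘ , belowₘ , maximal) = ∃-argmax (λ t → y t ZP.<? m t) m below₀
        (s , ms<ys , feasibleₘ) = exchange sm mB yB belowₘ
        (t , yt<mt , feasibleᵧ) = exchange sm yB mB ms<ys
        yt<ys = begin-strict
          y t        <⟨ yt<mt ⟩
          m t        ≤⟨ maximal yt<mt ⟩
          m tₘ       ≤⟨ ZP.≮⇒≥ (λ 1+ms<mtₘ → noStep s tₘ 1+ms<mtₘ feasibleₘ) ⟩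
          sucℤ (m s) ≤⟨ ZP.i<j⇒suc[i]≤j ms<ys ⟩
          y s        ∎
    in s , t , ms<ys , yt<mt , yt<ys , feasibleᵧ
    where open ZP.≤-Reasoning

  surplus : (Fin n → ℤ) → ℤ
  surplus y = sum (λ e → excess (m e) (y e))

  surplus-nonneg : ∀ y → 0ℤ ≤ surplus y
  surplus-nonneg y =
    subst (_≤ surplus y) (sum-replicate-zero n) (sum-mono-≤ (λ e → excess-nonneg (m e) (y e)))

  surplus-transfer : ∀ y {s t} → m s < y s → y t < m t → t ≢ s → surplus (transfer y t s) < surplus y
  surplus-transfer y {s} {t} ms<ys yt<mt t≢s =
    subst (_< surplus y) (sym (sum-transfer (λ e → excess (m e)) y t≢s)) (i+[j-k]<i (surplus y) 0<1)
    where
    0<1 : Δ (excess (m t)) (y t) < Δ (excess (m s)) (pred (y s))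
    0<1 = subst₂ _<_ (sym (Δexcess-< yt<mt)) (sym (Δexcess-≥ (ZP.i<j⇒i≤pred[j] ms<ys))) (+<+ (s≤s z≤n))

  _≺_ : Rel (Fin n → ℤ) 0ℓ
  _≺_ y' y = ∣ surplus y' ∣ ℕ.< ∣ surplus y ∣

  ≺-wellFounded : WellFounded _≺_
  ≺-wellFounded = On.wellFounded (∣_∣ ∘ surplus) NI.<-wellFounded

  surplus-<⇒≺ : ∀ {y' y} → surplus y' < surplus y → y' ≺ y
  surplus-<⇒≺ {y'} = ∣∣-mono-< (surplus-nonneg y')
    where
    ∣∣-mono-< : ∀ {i j} → 0ℤ ≤ i → i < j → ∣ i ∣ ℕ.< ∣ j ∣
    ∣∣-mono-< (+≤+ _) (+<+ i<j) = i<j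

  minimises-convex : ∀ F → Convex F → ∀ y → InB p y → sum (λ e → F (m e)) ≤ sum (λ e → F (y e))
  minimises-convex F convex y = go (≺-wellFounded y)
    where
    go : ∀ {y} → Acc _≺_ y → InB p y → sum (λ e → F (m e)) ≤ sum (λ e → F (y e))
    go {y} (acc descend) yB with ≗-dec ZP._≟_ y m
    ... | yes y≗m = ZP.≤-reflexive (sum-cong-≗ (λ e → cong F (sym (y≗m e))))
    ... | no y≉m =
      let (s , t , ms<ys , yt<mt , yt<ys , feasible) = improving-transfer {y} yB y≉m
          t≢s = coordinate-<⇒≢ {z = y} yt<ys
          closer = surplus-<⇒≺ {transfer y t s} {y} (surplus-transfer y ms<ys yt<mt t≢s)
      in ZP.≤-trans (go (descend closer) feasible) (sum-transfer-≤ F convex y t≢s yt<ys)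

sqSum≡sum : ∀ {n} (z : Fin n → ℤ) → sqSum z ≡ sum (λ e → square (z e))
sqSum≡sum z = ΣS≡sum (λ e → square (z e))

sqSum-transfer-< : ∀ {n} (z : Fin n → ℤ) {s t} → sucℤ (z s) < z t → sqSum (transfer z s t) < sqSum z
sqSum-transfer-< z {s} {t} 1+zs<zt =
  subst₂ _<_ (sym (sqSum≡sum (transfer z s t))) (sym (sqSum≡sum z))
    (sum-transfer-< square square-strictlyConvex z (coordinate-<⇒≢ {z = z} zs<zt) 1+zs<zt)
  where
  zs<zt = ZP.suc[i]≤j⇒i<j (ZP.<⇒≤ 1+zs<zt)

sqMin⇒noTighteningStep : ∀ {n} {p : Subset n → ℤ∞} {m} → SqMin p m → NoTighteningStep p m
sqMin⇒noTighteningStep {m = m} (_ , minimal) s t 1+ms<mt feasible =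
  ZP.<⇒≱ (sqSum-transfer-< m 1+ms<mt) (minimal (transfer m s t) feasible)

-- A tightening step lowers the square-sum but raises no Σ (v − k)⁺, so its decreasing
-- rearrangement is lexicographically at most, hence by minimality equal to, that of m.
decMin⇒noTighteningStep : ∀ {n} {p : Subset n → ℤ∞} {m} → DecMin p m → NoTighteningStep p m
decMin⇒noTighteningStep {m = m} (_ , minimal) s t 1+ms<mt feasible =
  ZP.<-irrefl sqSum-unchanged (sqSum-transfer-< m 1+ms<mt)
  where
  m' = transfer m s t
  ms<mt = ZP.suc[i]≤j⇒i<j (ZP.<⇒≤ 1+ms<mt)
  flatter : ∀ k → Σℤ (map (excess k) (m' ↓)) ≤ Σℤ (map (excess k) (m ↓))
  flatter k = subst₂ _≤_ (sym (Σℤ-map-↓ (excess k) m')) (sym (Σℤ-map-↓ (excess k) m))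
    (sum-transfer-≤ (excess k) (excess-convex k) m (coordinate-<⇒≢ {z = m} ms<mt) ms<mt)
  same-rearrangement : m' ↓ ≡ m ↓
  same-rearrangement = LexLeq-antisym
    (excess≤⇒LexLeq (m' ↓) (m ↓) (↓-descending m) (trans (length-↓ m') (sym (length-↓ m))) flatter)
    (minimal m' feasible)
  sqSum-unchanged : sqSum m' ≡ sqSum m
  sqSum-unchanged = begin
    sqSum m'                    ≡⟨ sqSum≡sum m' ⟩
    sum (λ e → square (m' e))   ≡⟨ Σℤ-map-↓ square m' ⟨
    Σℤ (map square (m' ↓))      ≡⟨ cong (Σℤ ∘′ map square) same-rearrangement ⟩
    Σℤ (map square (m ↓))       ≡⟨ Σℤ-map-↓ square m ⟩
    sum (λ e → square (m e))    ≡⟨ sqSum≡sum m ⟨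
    sqSum m                     ∎
    where
    open ≡-Reasoning

module _ {n} {p : Subset n → ℤ∞} {m} (sm : IsSupermodularSetFn p) (mB : InB p m)
  (noStep : NoTighteningStep p m) where

  open Descent sm mB noStep

  noTighteningStep⇒sqMin : SqMin p m
  noTighteningStep⇒sqMin = mB , λ z zB →
    subst₂ _≤_ (sym (sqSum≡sum m)) (sym (sqSum≡sum z)) (minimises-convex square square-convex z zB)

  noTighteningStep⇒decMin : DecMin p m
  noTighteningStep⇒decMin = mB , λ y yB →
    excess≤⇒LexLeq (m ↓) (y ↓) (↓-descending y) (trans (length-↓ m) (sym (length-↓ y))) λ k →
      subst₂ _≤_ (sym (Σℤ-map-↓ (excess k) m)) (sym (Σℤ-map-↓ (excess k) y))
        (minimises-convex (excess k) (excess-convex k) y yB)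

corollary6p6 : (n : ℕ) → (p : Subset (suc n) → ℤ∞) → IsSupermodularSetFn p →
    (m : Fin (suc n) → ℤ) → InB p m → (SqMin p m ⇔ DecMin p m)
corollary6p6 n p sm m mB = mk⇔
  (λ sqMin → noTighteningStep⇒decMin sm mB (sqMin⇒noTighteningStep sqMin))
  (λ decMin → noTighteningStep⇒sqMin sm mB (decMin⇒noTighteningStep decMin))
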